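{- Let $n,k$ be positive integers with $4\le 2k\le n$ and let $\mathcal{G}\subseteq 2^{[n]}$ be a collection of subsets of $[n]$, each with at most $k$ elements. Then the family $\mathcal{F}(\mathcal{G})=\{S\in\binom{[n]}{k}: S\preceq G\text{ for some }G\in\mathcal{G}\}$ is intersecting if and only if $G$ and $H$ are strongly intersecting for all $G,H\in\mathcal{G}$ (possibly identical).
   Context: $[n]=\{1,\dots,n\}$; sets are listed in increasing order. For $A=\{a_1<\dots<a_r\}$ and $B=\{b_1<\dots<b_s\}$, $A\preceq B$ means $r\ge s$ and $a_i\le b_i$ for $1\le i\le s$; for sets of equal size $r$, $A\le B$ means $a_i\le b_i$ for $1\le i\le r$. Two sets $A,B\subseteq[n]$ are strongly intersecting if for all $A',B'\subseteq[n]$ with $|A'|=|A|$, $A'\le A$, $|B'|=|B|$, $B'\le B$, one has $A'\cap B'\neq\emptyset$. A family is intersecting if any two of its members intersect. -}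

module Defs where

open import Data.Nat using (ℕ; _≤_; _<_)
open import Data.List using (List; []; _∷_; length)
open import Data.List.Relation.Unary.All using (All)
open import Data.List.Relation.Unary.Linked using (Linked)
open import Data.List.Relation.Binary.Pointwise using (Pointwise)
open import Data.List.Membership.Propositional using (_∈_)
open import Data.Product using (Σ; ∃; _×_)
open import Relation.Binary.PropositionalEquality using (_≡_)

-- A subset of [n] = {1,…,n} is represented by the list of its elements
-- in strictly increasing order, all lying in [1, n].
IsSubsetOf : ℕ → List ℕ → Set
IsSubsetOf n A = Linked _<_ A × All (λ a → 1 ≤ a × a ≤ n) A

_≤ₛ_ : List ℕ → List ℕ → Set
A ≤ₛ B = Pointwise _≤_ A B

-- A ⪯ B : |A| ≥ |B| and a_i ≤ b_i for 1 ≤ i ≤ |B|.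
data _⪯_ : List ℕ → List ℕ → Set where
  ⪯-[] : ∀ {A} → A ⪯ []
  ⪯-∷  : ∀ {a b A B} → a ≤ b → A ⪯ B → (a ∷ A) ⪯ (b ∷ B)

Meet : List ℕ → List ℕ → Set
Meet A B = ∃ λ x → x ∈ A × x ∈ B

StronglyIntersecting : ℕ → List ℕ → List ℕ → Set
StronglyIntersecting n A B =
  ∀ A' B' → IsSubsetOf n A' → IsSubsetOf n B' →
  length A' ≡ length A → A' ≤ₛ A →
  length B' ≡ length B → B' ≤ₛ B →
  Meet A' B'

Intersecting : (List ℕ → Set) → Set
Intersecting 𝓕 = ∀ A B → 𝓕 A → 𝓕 B → Meet A B

𝓕 : ℕ → ℕ → (List ℕ → Set) → List ℕ → Set
𝓕 n k 𝓖 S = IsSubsetOf n S × length S ≡ k × (∃ λ G → 𝓖 G × S ⪯ G)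

{-# OPTIONS --safe #-}
-- If F(𝓖) contained disjoint sets S ⪯ G and T ⪯ H, then the first |G| elements
-- of S and the first |H| elements of T would witness that G and H are not
-- strongly intersecting.  Conversely, given disjoint A ≤ G and B ≤ H inside [n],
-- extend A and B to disjoint k-subsets S ⊇ A and T ⊇ B of [n], which is possible
-- as 2k ≤ n.  A sorted superset dominates its subsets, so S ⪯ A ≤ G and
-- T ⪯ B ≤ H put S and T in F(𝓖), which is then not intersecting.
module Submission where

open import Defs
open import Data.Nat using (ℕ; zero; suc; _+_; _∸_; _*_; _≤_; _<_; _≟_; s≤s; s≤s⁻¹; z<s)
open import Data.Nat.Properties
  using ( ≤-refl; ≤-trans; ≤-<-trans; <⇒≤; <⇒≢; <-trans; <-irrefl; ≤∧≢⇒<; n<1+n; m<m+n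
        ; +-suc; +-identityʳ; m+[n∸m]≡n; module ≤-Reasoning)
open import Data.List using (List; []; _∷_; length; take)
open import Data.List.Relation.Unary.All as All using (All; []; _∷_)
open import Data.List.Relation.Unary.Any using (here; there; any?)
open import Data.List.Relation.Unary.AllPairs as AllPairs using (AllPairs; []; _∷_)
open import Data.List.Relation.Unary.Linked as Linked using (Linked; []; [-]; _∷_)
open import Data.List.Relation.Unary.Linked.Properties using (Linked⇒AllPairs; AllPairs⇒Linked)
open import Data.List.Relation.Unary.Unique.Propositional using (Unique)
open import Data.List.Relation.Binary.Pointwise using ([]; _∷_; Pointwise-length)
open import Data.List.Relation.Binary.Sublist.Propositional
  using (_⊆_; []; _∷_; _∷ʳ_; ⊆-refl; minimum; lookup)
open import Data.List.Relation.Binary.Sublist.Propositional.Properties using (All-resp-⊆; take-⊆)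
open import Data.List.Relation.Binary.Disjoint.Propositional using (Disjoint; contractₗ; contractᵣ)
open import Data.List.Membership.Propositional using (_∈_; find; lose)
open import Data.List.Membership.DecPropositional _≟_ using (_∈?_)
open import Data.Product using (_×_; _,_; proj₁; proj₂)
open import Data.Empty using (⊥-elim)
open import Function using (_∘′_)
open import Function.Bundles using (_⇔_; mk⇔)
open import Level using (Level)
open import Relation.Binary.Core using (Rel)
open import Relation.Binary.Definitions using (Transitive)
open import Relation.Binary.PropositionalEquality using (_≡_; _≢_; refl; sym; trans; cong; cong₂; subst)
open import Relation.Nullary.Decidable using (Dec; yes; no; map′; decidable-stable)

private
  variable
    a ℓ : Level
    X : Set a

AllPairs-resp-⊆ : ∀ {R : Rel X ℓ} {xs ys} → xs ⊆ ys → AllPairs R ys → AllPairs R xs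
AllPairs-resp-⊆ []         []         = []
AllPairs-resp-⊆ (_ ∷ʳ τ)   (_  ∷ rys) = AllPairs-resp-⊆ τ rys
AllPairs-resp-⊆ (refl ∷ τ) (ry ∷ rys) = All-resp-⊆ τ ry ∷ AllPairs-resp-⊆ τ rys

Linked-resp-⊆ : ∀ {R : Rel X ℓ} {xs ys} → Transitive R → xs ⊆ ys → Linked R ys → Linked R xs
Linked-resp-⊆ R-trans τ = AllPairs⇒Linked ∘′ AllPairs-resp-⊆ τ ∘′ Linked⇒AllPairs R-trans

IsSubsetOf-resp-⊆ : ∀ {n xs ys} → xs ⊆ ys → IsSubsetOf n ys → IsSubsetOf n xs
IsSubsetOf-resp-⊆ τ (sorted , bounded) = Linked-resp-⊆ <-trans τ sorted , All-resp-⊆ τ bounded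

strictlySorted⇒Unique : ∀ {xs} → Linked _<_ xs → Unique xs
strictlySorted⇒Unique = AllPairs.map <⇒≢ ∘′ Linked⇒AllPairs <-trans

meet? : ∀ xs ys → Dec (Meet xs ys)
meet? xs ys = map′ find (λ (_ , x∈xs , x∈ys) → lose x∈xs x∈ys) (any? (_∈? ys) xs)

⪯-trans : ∀ {xs ys zs} → xs ⪯ ys → ys ⪯ zs → xs ⪯ zs
⪯-trans _                ⪯-[]             = ⪯-[]
⪯-trans (⪯-∷ x≤y xs⪯ys) (⪯-∷ y≤z ys⪯zs) = ⪯-∷ (≤-trans x≤y y≤z) (⪯-trans xs⪯ys ys⪯zs)

⪯-≤ₛ-trans : ∀ {xs ys zs} → xs ⪯ ys → ys ≤ₛ zs → xs ⪯ zs
⪯-≤ₛ-trans ⪯-[]             []              = ⪯-[]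
⪯-≤ₛ-trans (⪯-∷ x≤y xs⪯ys) (y≤z ∷ ys≤zs) = ⪯-∷ (≤-trans x≤y y≤z) (⪯-≤ₛ-trans xs⪯ys ys≤zs)

sorted⇒∷⪯ : ∀ {x xs} → Linked _≤_ (x ∷ xs) → (x ∷ xs) ⪯ xs
sorted⇒∷⪯ [-]            = ⪯-[]
sorted⇒∷⪯ (x≤y ∷ sorted) = ⪯-∷ x≤y (sorted⇒∷⪯ sorted)

sorted-⊇⇒⪯ : ∀ {xs ys} → Linked _≤_ ys → xs ⊆ ys → ys ⪯ xs
sorted-⊇⇒⪯ _      []         = ⪯-[]
sorted-⊇⇒⪯ sorted (_ ∷ʳ τ)   = ⪯-trans (sorted⇒∷⪯ sorted) (sorted-⊇⇒⪯ (Linked.tail sorted) τ)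
sorted-⊇⇒⪯ sorted (refl ∷ τ) = ⪯-∷ ≤-refl (sorted-⊇⇒⪯ (Linked.tail sorted) τ)

⪯⇒take≤ₛ : ∀ {xs ys} → xs ⪯ ys → take (length ys) xs ≤ₛ ys
⪯⇒take≤ₛ ⪯-[]             = []
⪯⇒take≤ₛ (⪯-∷ x≤y xs⪯ys) = x≤y ∷ ⪯⇒take≤ₛ xs⪯ys

interval : ℕ → ℕ → List ℕ
interval m zero    = []
interval m (suc d) = m ∷ interval (suc m) d

length-interval : ∀ m d → length (interval m d) ≡ d
length-interval m zero    = refl
length-interval m (suc d) = cong suc (length-interval (suc m) d)

interval-sorted : ∀ m d → Linked _<_ (interval m d)
interval-sorted m zero          = []
interval-sorted m (suc zero)    = [-]
interval-sorted m (suc (suc d)) = n<1+n m ∷ interval-sorted (suc m) (suc d)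

∈-interval⁻ : ∀ {m d x} → x ∈ interval m d → m ≤ x × x < m + d
∈-interval⁻ {m} {suc d} (here refl) = ≤-refl , m<m+n m z<s
∈-interval⁻ {m} {suc d} {x} (there x∈) =
  let m<x , x<m+1+d = ∈-interval⁻ x∈ in <⇒≤ m<x , subst (x <_) (sym (+-suc m d)) x<m+1+d

sorted⊆interval : ∀ {m d xs} → AllPairs _<_ xs → All (m ≤_) xs → All (_< m + d) xs → xs ⊆ interval m d
sorted⊆interval {d = zero}  _ []        _           = []
sorted⊆interval {m} {zero}  _ (m≤x ∷ _) (x<m+0 ∷ _) =
  ⊥-elim (<-irrefl (sym (+-identityʳ m)) (≤-<-trans m≤x x<m+0))
sorted⊆interval {d = suc d} _ []        _           = minimum _
sorted⊆interval {m} {suc d} {x ∷ xs} sorted (m≤x ∷ _) x∷xs<m+1+d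
  rewrite +-suc m d with m ≟ x
... | yes refl = refl ∷ sorted⊆interval (AllPairs.tail sorted) (AllPairs.head sorted) (All.tail x∷xs<m+1+d)
... | no  m≢x  = m ∷ʳ sorted⊆interval sorted (m<x ∷ All.map (<-trans m<x) (AllPairs.head sorted)) x∷xs<m+1+d
  where
  m<x = ≤∧≢⇒< m≤x m≢x

IsSubsetOf-interval : ∀ n → IsSubsetOf n (interval 1 n)
IsSubsetOf-interval n = interval-sorted 1 n , All.tabulate bounds
  where
  bounds : ∀ {x} → x ∈ interval 1 n → 1 ≤ x × x ≤ n
  bounds x∈ = let 1≤x , x<1+n = ∈-interval⁻ x∈ in 1≤x , s≤s⁻¹ x<1+n

IsSubsetOf⇒⊆interval : ∀ {n xs} → IsSubsetOf n xs → xs ⊆ interval 1 n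
IsSubsetOf⇒⊆interval (sorted , bounded) =
  sorted⊆interval (Linked⇒AllPairs <-trans sorted) (All.map proj₁ bounded) (All.map (s≤s ∘′ proj₂) bounded)

record DisjointExtension {X : Set a} (C A B : List X) (p q : ℕ) : Set a where
  field
    S T      : List X
    S⊆C      : S ⊆ C
    T⊆C      : T ⊆ C
    A⊆S      : A ⊆ S
    B⊆T      : B ⊆ T
    length-S : length S ≡ length A + p
    length-T : length T ≡ length B + q
    S#T      : Disjoint S T

≡suc∧≤suc⇒≤ : ∀ {m n k} → m ≡ suc n → m ≤ suc k → n ≤ k
≡suc∧≤suc⇒≤ refl = s≤s⁻¹

module _ {X : Set a} where

  swap : ∀ {C A B : List X} {p q} → DisjointExtension C A B p q → DisjointExtension C B A q p
  swap E = record
    { S⊆C = T⊆C ; T⊆C = S⊆C ; A⊆S = B⊆T ; B⊆T = A⊆S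
    ; length-S = length-T ; length-T = length-S ; S#T = λ (x∈T , x∈S) → S#T (x∈S , x∈T) }
    where open DisjointExtension E

  ∷-disjoint : ∀ {c : X} {C S T} → All (c ≢_) C → T ⊆ C → Disjoint S T → Disjoint (c ∷ S) T
  ∷-disjoint c≢C T⊆C S#T (here refl  , c∈T) = All.lookup c≢C (lookup T⊆C c∈T) refl
  ∷-disjoint c≢C T⊆C S#T (there x∈S , x∈T) = S#T (x∈S , x∈T)

  consˡ : ∀ {c : X} {C A A′ B p p′ q} → All (c ≢_) C → (E : DisjointExtension C A B p q) →
          A′ ⊆ c ∷ DisjointExtension.S E → length A′ + p′ ≡ suc (length A + p) →
          DisjointExtension (c ∷ C) A′ B p′ q
  consˡ {c} c≢C E A′⊆c∷S length-A′ = record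
    { S⊆C = refl ∷ S⊆C ; T⊆C = c ∷ʳ T⊆C ; A⊆S = A′⊆c∷S ; B⊆T = B⊆T
    ; length-S = trans (cong suc length-S) (sym length-A′) ; length-T = length-T
    ; S#T = ∷-disjoint c≢C T⊆C S#T }
    where open DisjointExtension E

  keepˡ : ∀ {c : X} {C A B p q} → All (c ≢_) C →
          DisjointExtension C A B p q → DisjointExtension (c ∷ C) (c ∷ A) B p q
  keepˡ c≢C E = consˡ c≢C E (refl ∷ DisjointExtension.A⊆S E) refl

  freshˡ : ∀ {c : X} {C A B p q} → All (c ≢_) C →
           DisjointExtension C A B p q → DisjointExtension (c ∷ C) A B (suc p) q
  freshˡ {c} {p = p} c≢C E = consˡ c≢C E (c ∷ʳ DisjointExtension.A⊆S E) (+-suc _ p)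

  keepʳ : ∀ {c : X} {C A B p q} → All (c ≢_) C →
          DisjointExtension C A B p q → DisjointExtension (c ∷ C) A (c ∷ B) p q
  keepʳ c≢C = swap ∘′ keepˡ c≢C ∘′ swap

  freshʳ : ∀ {c : X} {C A B p q} → All (c ≢_) C →
           DisjointExtension C A B p q → DisjointExtension (c ∷ C) A B p (suc q)
  freshʳ c≢C = swap ∘′ freshˡ c≢C ∘′ swap

  extend : ∀ {C A B : List X} {p q} → Unique C → A ⊆ C → B ⊆ C → Disjoint A B →
           length A + p + (length B + q) ≤ length C → DisjointExtension C A B p q
  extend {p = zero} {zero} _ A⊆C B⊆C A#B _ = record
    { S⊆C = A⊆C ; T⊆C = B⊆C ; A⊆S = ⊆-refl ; B⊆T = ⊆-refl
    ; length-S = sym (+-identityʳ _) ; length-T = sym (+-identityʳ _) ; S#T = A#B }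
  extend {C = []} {p = suc _}        _ [] [] _ ()
  extend {C = []} {p = zero} {suc _} _ [] [] _ ()
  extend (_ ∷ _) (refl ∷ _) (refl ∷ _) A#B _ = ⊥-elim (A#B (here refl , here refl))
  extend (c≢C ∷ unique) (refl ∷ A⊆C) (_ ∷ʳ B⊆C) A#B fits =
    keepˡ c≢C (extend unique A⊆C B⊆C (contractₗ A#B) (s≤s⁻¹ fits))
  extend (c≢C ∷ unique) (_ ∷ʳ A⊆C) (refl ∷ B⊆C) A#B fits =
    keepʳ c≢C (extend unique A⊆C B⊆C (contractᵣ A#B) (≡suc∧≤suc⇒≤ (+-suc _ _) fits))
  extend {A = A} {B} {suc p} {q} (c≢C ∷ unique) (_ ∷ʳ A⊆C) (_ ∷ʳ B⊆C) A#B fits =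
    freshˡ c≢C (extend unique A⊆C B⊆C A#B (≡suc∧≤suc⇒≤ (cong (_+ (length B + q)) (+-suc (length A) p)) fits))
  extend {A = A} {B} {zero} {suc q} (c≢C ∷ unique) (_ ∷ʳ A⊆C) (_ ∷ʳ B⊆C) A#B fits =
    freshʳ c≢C (extend unique A⊆C B⊆C A#B (≡suc∧≤suc⇒≤ (trans (cong (length A + 0 +_) (+-suc (length B) q)) (+-suc _ _)) fits))

extend-in-interval : ∀ {n k A B} → 2 * k ≤ n → length A ≤ k → length B ≤ k →
                     IsSubsetOf n A → IsSubsetOf n B → Disjoint A B →
                     DisjointExtension (interval 1 n) A B (k ∸ length A) (k ∸ length B)
extend-in-interval {n} {k} {A} {B} 2k≤n |A|≤k |B|≤k A⊆[n] B⊆[n] A#B =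
  extend (strictlySorted⇒Unique (interval-sorted 1 n))
         (IsSubsetOf⇒⊆interval A⊆[n]) (IsSubsetOf⇒⊆interval B⊆[n]) A#B fits
  where
  open ≤-Reasoning
  fits : length A + (k ∸ length A) + (length B + (k ∸ length B)) ≤ length (interval 1 n)
  fits = begin
    length A + (k ∸ length A) + (length B + (k ∸ length B)) ≡⟨ cong₂ _+_ (m+[n∸m]≡n |A|≤k) (m+[n∸m]≡n |B|≤k) ⟩
    k + k                                                   ≡⟨ cong (k +_) (sym (+-identityʳ k)) ⟩
    2 * k                                                   ≤⟨ 2k≤n ⟩
    n                                                       ≡⟨ length-interval 1 n ⟨
    length (interval 1 n)                                   ∎

strongly-intersecting-⪯⇒meet : ∀ {n G H S T} → StronglyIntersecting n G H → IsSubsetOf n S → IsSubsetOf n T →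
         S ⪯ G → T ⪯ H → Meet S T
strongly-intersecting-⪯⇒meet {G = G} {H} {S} {T} G≬H S⊆[n] T⊆[n] S⪯G T⪯H =
  let x , x∈S′ , x∈T′ = G≬H S′ T′ (IsSubsetOf-resp-⊆ S′⊆S S⊆[n]) (IsSubsetOf-resp-⊆ T′⊆T T⊆[n])
                                  (Pointwise-length S′≤G) S′≤G (Pointwise-length T′≤H) T′≤H
  in x , lookup S′⊆S x∈S′ , lookup T′⊆T x∈T′
  where
  S′ = take (length G) S
  T′ = take (length H) T
  S′⊆S = take-⊆ (length G) S
  T′⊆T = take-⊆ (length H) T
  S′≤G = ⪯⇒take≤ₛ S⪯G
  T′≤H = ⪯⇒take≤ₛ T⪯H

module _ {n k : ℕ} {𝓖 : List ℕ → Set} where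

  superset-∈𝓕 : ∀ {G A S} → 𝓖 G → A ≤ₛ G → IsSubsetOf n S → A ⊆ S → length S ≡ k → 𝓕 n k 𝓖 S
  superset-∈𝓕 G∈𝓖 A≤G S⊆[n] A⊆S |S|≡k =
    S⊆[n] , |S|≡k , _ , G∈𝓖 , ⪯-≤ₛ-trans (sorted-⊇⇒⪯ (Linked.map <⇒≤ (proj₁ S⊆[n])) A⊆S) A≤G

  strongly⇒𝓕-intersecting : (∀ G H → 𝓖 G → 𝓖 H → StronglyIntersecting n G H) → Intersecting (𝓕 n k 𝓖)
  strongly⇒𝓕-intersecting 𝓖≬ S T (S⊆[n] , _ , G , G∈𝓖 , S⪯G) (T⊆[n] , _ , H , H∈𝓖 , T⪯H) =
    strongly-intersecting-⪯⇒meet (𝓖≬ G H G∈𝓖 H∈𝓖) S⊆[n] T⊆[n] S⪯G T⪯H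

  𝓕-intersecting⇒strongly : 2 * k ≤ n → (∀ G → 𝓖 G → length G ≤ k) → Intersecting (𝓕 n k 𝓖) →
                            ∀ G H → 𝓖 G → 𝓖 H → StronglyIntersecting n G H
  𝓕-intersecting⇒strongly 2k≤n |𝓖|≤k 𝓕-meet G H G∈𝓖 H∈𝓖 A B A⊆[n] B⊆[n] _ A≤G _ B≤H =
    decidable-stable (meet? A B) λ A∌B →
      let open DisjointExtension
            (extend-in-interval 2k≤n (≤k G∈𝓖 A≤G) (≤k H∈𝓖 B≤H) A⊆[n] B⊆[n] (λ x∈A∩B → A∌B (_ , x∈A∩B)))
      in S#T (proj₂ (𝓕-meet S T (member G∈𝓖 A≤G S⊆C A⊆S length-S) (member H∈𝓖 B≤H T⊆C B⊆T length-T)))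
    where
    ≤k : ∀ {G A} → 𝓖 G → A ≤ₛ G → length A ≤ k
    ≤k {G} G∈𝓖 A≤G = subst (_≤ k) (sym (Pointwise-length A≤G)) (|𝓖|≤k G G∈𝓖)
    member : ∀ {G A S} → 𝓖 G → A ≤ₛ G → S ⊆ interval 1 n → A ⊆ S → length S ≡ length A + (k ∸ length A) →
             𝓕 n k 𝓖 S
    member G∈𝓖 A≤G S⊆[1,n] A⊆S |S|≡ = superset-∈𝓕 G∈𝓖 A≤G (IsSubsetOf-resp-⊆ S⊆[1,n] (IsSubsetOf-interval n))
                                        A⊆S (trans |S|≡ (m+[n∸m]≡n (≤k G∈𝓖 A≤G)))

lemma2p2 : (n k : ℕ) → 4 ≤ 2 * k → 2 * k ≤ n →
    (𝓖 : List ℕ → Set) →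
    (∀ G → 𝓖 G → IsSubsetOf n G) →
    (∀ G → 𝓖 G → length G ≤ k) →
    Intersecting (𝓕 n k 𝓖) ⇔ (∀ G H → 𝓖 G → 𝓖 H → StronglyIntersecting n G H)
lemma2p2 n k _ 2k≤n 𝓖 _ |𝓖|≤k = mk⇔ (𝓕-intersecting⇒strongly 2k≤n |𝓖|≤k) strongly⇒𝓕-intersecting
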